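{- Let $n\in\{pqr,\ pqrs : p,q,r,s \text{ distinct primes}\}$. Let $S\subseteq\mathbb{Z}_n$ be square-free and aperiodic with $|S|=pq$, and suppose $|S|\mid n$ and $\gcd(|S|,n/|S|)=1$. Then the connected Cayley sum graph $\mathrm{CS}(\mathbb{Z}_n,S)$ admits a total perfect code if and only if $s\not\equiv s'\pmod{pq}$ for all distinct $s,s'\in S$.
   Context: For an abelian group $G$ and $S\subseteq G$, the Cayley sum graph $\mathrm{CS}(G,S)$ has vertex set $G$, two vertices $g,h$ adjacent iff $g+h\in S$ and $g\neq h$. A total perfect code of a graph is a set $C$ of vertices such that every vertex has exactly one neighbor in $C$. $S$ is square-free if it contains no element of the form $y+y$, $y\in G$. A nonempty $X\subseteq G$ is aperiodic if its stabilizer $\{g\in G: X+g=X\}$ equals $\{0\}$. The hypothesis "connected" means the lemma concerns those $S$ for which $\mathrm{CS}(\mathbb{Z}_n,S)$ is connected. Elements of $\mathbb{Z}_n$ are identified with integers $0,\dots,n-1$. -}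

module Defs where

open import Data.Nat using (ℕ; zero; suc; _+_; _*_)
open import Data.Nat.DivMod using (_mod_)
open import Data.Fin using (Fin; toℕ)
open import Data.Fin.Subset using (Subset; _∈_; _∉_)
open import Data.Product using (Σ; ∃; ∃₂; _×_; _,_)
open import Relation.Binary.PropositionalEquality using (_≡_)
open import Relation.Nullary using (¬_)
open import Function.Bundles using (_⇔_)

infixl 6 _⊕_
_⊕_ : {n : ℕ} → Fin n → Fin n → Fin n
_⊕_ {suc m} a b = (toℕ a + toℕ b) mod (suc m)

Adj : {n : ℕ} → Subset n → Fin n → Fin n → Set
Adj S g h = (g ⊕ h) ∈ S × ¬ (g ≡ h)

data Reach {n : ℕ} (S : Subset n) : Fin n → Fin n → Set where
  here : ∀ {g} → Reach S g g
  step : ∀ {g h k} → Adj S g h → Reach S h k → Reach S g k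

Connected : {n : ℕ} → Subset n → Set
Connected S = ∀ g h → Reach S g h

SquareFree : {n : ℕ} → Subset n → Set
SquareFree S = ∀ y → (y ⊕ y) ∉ S

Stabilizes : {n : ℕ} → Subset n → Fin n → Set
Stabilizes X g = ∀ x → (x ∈ X) ⇔ ((x ⊕ g) ∈ X)

Aperiodic : {n : ℕ} → Subset n → Set
Aperiodic X = ∀ g → Stabilizes X g → toℕ g ≡ 0

TotalPerfectCode : {n : ℕ} → Subset n → Subset n → Set
TotalPerfectCode S C =
  ∀ g → Σ (Fin _) (λ c → c ∈ C × Adj S g c
          × (∀ c' → c' ∈ C → Adj S g c' → c' ≡ c))

_≡_[mod_] : ℕ → ℕ → ℕ → Set
a ≡ b [mod m ] = ∃₂ λ k l → a + k * m ≡ b + l * m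

module Submission where

-- A total perfect code C of CS(ℤₙ, S) is the same as a tiling (−C) ⊕ S = ℤₙ: every g is uniquely
-- −c + s, because g + c = s.  If S meets each residue class mod pq exactly once, the multiples of
-- pq form such a code.  Conversely, put A = −C, so |A| = m = n/pq.  Tijdeman's dilation lemma (if
-- A ⊕ S tiles and the prime ℓ does not divide |A|, then ℓA ⊕ S tiles; proved by counting the
-- ℓ-tuples of A and their products modulo ℓ, the cyclic rotation of tuples acting as on necklaces)
-- applied with ℓ = p and ℓ = q gives a tiling pqA ⊕ S whose first factor consists of m multiples
-- of pq.  Two elements s ≠ s′ of S in one class mod pq would then give 2m distinct elements
-- s + pqA, s′ + pqA in a residue class with only m elements.

module Counting where

  open import Algebra.Bundles using (CommutativeSemigroup; Group)
  open import Algebra.Core using (Op₁; Op₂)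
  open import Algebra.Structures using (IsAbelianGroup)
  open import Data.Empty using (⊥; ⊥-elim)
  open import Data.List.Base
    using (List; []; _∷_; [_]; _++_; applyUpTo; cartesianProductWith; filter; foldr; length; map; replicate)
  open import Data.List.Membership.Propositional using (_∈_; _∉_; find; lose)
  import Data.List.Membership.DecPropositional as DecMembership
  open import Data.List.Membership.Propositional.Properties
    using ( ∈-applyUpTo⁺; ∈-applyUpTo⁻; ∈-cartesianProductWith⁺; ∈-cartesianProductWith⁻
          ; ∈-filter⁺; ∈-filter⁻; ∈-map⁺; ∈-map⁻; ∈-upTo⁺)
  open import Data.List.Membership.Propositional.Properties.WithK using (unique∧set⇒bag)
  open import Data.List.Properties
    using ( ≡-dec; ∷-injective; ∷-injectiveˡ; ++-assoc; ++-identityʳ; filter-all; filter-notAll; length-++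
          ; length-applyUpTo; length-filter; length-map; length-replicate; length-upTo; map-++)
  open import Data.List.Relation.Binary.BagAndSetEquality using (∼bag⇒↭)
  open import Data.List.Relation.Binary.Permutation.Propositional using (_↭_)
  open import Data.List.Relation.Binary.Permutation.Propositional.Properties
    using (↭-length) renaming (map⁺ to ↭-map⁺)
  import Data.List.Relation.Unary.All as All
  import Data.List.Relation.Unary.All.Properties as All
  open import Data.List.Relation.Unary.AllPairs using ([]; _∷_)
  open import Data.List.Relation.Unary.Any using (here; there)
  open import Data.List.Relation.Unary.Unique.Propositional using (Unique)
  open import Data.List.Relation.Unary.Unique.Propositional.Properties
    using (Unique[x∷xs]⇒x∉xs; applyUpTo⁺₁; cartesianProductWith⁺; upTo⁺)
    renaming (++⁺ to unique-++⁺; filter⁺ to unique-filter⁺; map⁺ to unique-map⁺)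
  import Data.Nat as ℕ
  open import Data.Nat.Base using (ℕ; zero; suc; pred; _+_; _*_; _∸_; _^_; _≤_; _<_; z≤n; z<s; >-nonZero)
  open import Data.Nat.Coprimality using (coprime-Bézout; prime⇒coprime)
  open import Data.Nat.Divisibility using (_∣_; divides; ∣1⇒≡1)
  import Data.Nat.GCD as GCD
  open import Data.Nat.GeneralisedArithmetic using (iterate)
  open import Data.Nat.Induction using (<-wellFounded)
  open import Data.Nat.ListAction using (sum)
  open import Data.Nat.ListAction.Properties using (sum-++; sum-↭)
  open import Data.Nat.Primality using (Prime; prime⇒nonZero; ¬prime[0]; ¬prime[1]; euclidsLemma)
  open import Data.Nat.Properties
    using ( *-identityʳ; *-zeroʳ; +-assoc; +-cancelʳ-≤; +-cancelˡ-≤; +-comm; +-commutativeSemigroup; +-identityʳ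
          ; +-mono-≤; +-monoʳ-≤; +-monoˡ-≤; <-trans; <⇒≤; <⇒≱; m+[n∸m]≡n; m<n⇒0<n∸m; m∸n≤m; m≤m+n; m≤n+m
          ; m≤n⇒m<n∨m≡n; n≢0⇒n>0; suc-pred; ≤-<-trans; ≤-antisym; ≤-reflexive; ≤-trans; module ≤-Reasoning)
  open import Algebra.Properties.CommutativeSemigroup +-commutativeSemigroup
    using () renaming (interchange to +-interchange; x∙yz≈y∙xz to +-exchange)
  open import Data.Nat.Tactic.RingSolver using (solve-∀)
  open import Data.Product.Base using (∃-syntax; _×_; _,_; proj₁; proj₂)
  open import Data.Sum.Base using (inj₁; inj₂)
  open import Function.Base using (_∘_)
  open import Function.Bundles using (_⇔_; mk⇔; Equivalence)
  open import Induction.WellFounded using (Acc; acc)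
  open import Level using (0ℓ)
  open import Relation.Binary.Definitions using (DecidableEquality)
  open import Relation.Binary.PropositionalEquality using (_≡_; _≢_; refl; sym; trans; cong; cong₂; subst; module ≡-Reasoning)
  open import Relation.Nullary using (¬_; Dec; yes; no; ¬?)

  ∑ : {A : Set} → List A → (A → ℕ) → ℕ
  ∑ xs f = sum (map f xs)

  syntax ∑ xs (λ x → e) = ∑[ x ∈ xs ] e

  𝟙 : {P : Set} → Dec P → ℕ
  𝟙 (yes _) = 1
  𝟙 (no _)  = 0

  𝟙-yes : {P : Set} (p? : Dec P) → P → 𝟙 p? ≡ 1
  𝟙-yes (yes _) _ = refl
  𝟙-yes (no ¬p) p = ⊥-elim (¬p p)

  𝟙-no : {P : Set} (p? : Dec P) → ¬ P → 𝟙 p? ≡ 0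
  𝟙-no (yes p) ¬p = ⊥-elim (¬p p)
  𝟙-no (no _)  _  = refl

  𝟙-cong : {P Q : Set} (p? : Dec P) (q? : Dec Q) → P ⇔ Q → 𝟙 p? ≡ 𝟙 q?
  𝟙-cong (yes p) q? P⇔Q = sym (𝟙-yes q? (Equivalence.to P⇔Q p))
  𝟙-cong (no ¬p) q? P⇔Q = sym (𝟙-no q? (¬p ∘ Equivalence.from P⇔Q))

  private
    variable
      A B C : Set

  ∑-cong : ∀ xs {f g : A → ℕ} → (∀ {x} → x ∈ xs → f x ≡ g x) → ∑ xs f ≡ ∑ xs g
  ∑-cong []       f≡g = refl
  ∑-cong (x ∷ xs) f≡g = cong₂ _+_ (f≡g (here refl)) (∑-cong xs (f≡g ∘ there))

  ∑-++ : ∀ xs ys (f : A → ℕ) → ∑ (xs ++ ys) f ≡ ∑ xs f + ∑ ys f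
  ∑-++ xs ys f = trans (cong sum (map-++ f xs ys)) (sum-++ (map f xs) (map f ys))

  ∑-const : (xs : List A) (c : ℕ) → ∑[ _ ∈ xs ] c ≡ length xs * c
  ∑-const []       c = refl
  ∑-const (x ∷ xs) c = cong (c +_) (∑-const xs c)

  ∑-length : (xs : List A) → ∑[ _ ∈ xs ] 1 ≡ length xs
  ∑-length xs = trans (∑-const xs 1) (*-identityʳ (length xs))

  ∑-zero : ∀ xs {f : A → ℕ} → (∀ {x} → x ∈ xs → f x ≡ 0) → ∑ xs f ≡ 0
  ∑-zero xs f≡0 = trans (∑-cong xs f≡0) (trans (∑-const xs 0) (*-zeroʳ (length xs)))

  ∑-distrib-+ : ∀ xs (f g : A → ℕ) → ∑[ x ∈ xs ] (f x + g x) ≡ ∑ xs f + ∑ xs g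
  ∑-distrib-+ []       f g = refl
  ∑-distrib-+ (x ∷ xs) f g = begin
    f x + g x + ∑[ x ∈ xs ] (f x + g x) ≡⟨ cong (f x + g x +_) (∑-distrib-+ xs f g) ⟩
    f x + g x + (∑ xs f + ∑ xs g)       ≡⟨ +-interchange (f x) (g x) (∑ xs f) (∑ xs g) ⟩
    f x + ∑ xs f + (g x + ∑ xs g)       ∎
    where open ≡-Reasoning

  ∑-mono-≤ : ∀ xs {f g : A → ℕ} → (∀ {x} → x ∈ xs → f x ≤ g x) → ∑ xs f ≤ ∑ xs g
  ∑-mono-≤ []       f≤g = z≤n
  ∑-mono-≤ (x ∷ xs) f≤g = +-mono-≤ (f≤g (here refl)) (∑-mono-≤ xs (f≤g ∘ there))

  ∈⇒≤∑ : ∀ {xs x} (f : A → ℕ) → x ∈ xs → f x ≤ ∑ xs f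
  ∈⇒≤∑ {xs = y ∷ xs} f (here refl) = m≤m+n (f y) (∑ xs f)
  ∈⇒≤∑ {xs = y ∷ xs} f (there x∈xs) = ≤-trans (∈⇒≤∑ f x∈xs) (m≤n+m (∑ xs f) (f y))

  ≢-∈⇒+≤∑ : ∀ {xs x y} (f : A → ℕ) → x ∈ xs → y ∈ xs → x ≢ y → f x + f y ≤ ∑ xs f
  ≢-∈⇒+≤∑ {xs = z ∷ xs} f (here refl)  (here refl)  x≢y = ⊥-elim (x≢y refl)
  ≢-∈⇒+≤∑ {xs = z ∷ xs} f (here refl)  (there y∈xs) _   = +-monoʳ-≤ (f z) (∈⇒≤∑ f y∈xs)
  ≢-∈⇒+≤∑ {xs = z ∷ xs} f (there x∈xs) (here refl)  _   =
    subst (_≤ ∑ (z ∷ xs) f) (+-comm (f z) _) (+-monoʳ-≤ (f z) (∈⇒≤∑ f x∈xs))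
  ≢-∈⇒+≤∑ {xs = z ∷ xs} f (there x∈xs) (there y∈xs) x≢y =
    ≤-trans (≢-∈⇒+≤∑ f x∈xs y∈xs x≢y) (m≤n+m (∑ xs f) (f z))

  ∑-↭ : ∀ {xs ys} (f : A → ℕ) → xs ↭ ys → ∑ xs f ≡ ∑ ys f
  ∑-↭ f xs↭ys = sum-↭ (↭-map⁺ f xs↭ys)

  ∑-partition : ∀ {P : A → Set} (P? : ∀ x → Dec (P x)) xs (f : A → ℕ) →
                ∑ xs f ≡ ∑ (filter P? xs) f + ∑ (filter (¬? ∘ P?) xs) f
  ∑-partition P? []       f = refl
  ∑-partition P? (x ∷ xs) f with P? x
  ... | yes _ = trans (cong (f x +_) (∑-partition P? xs f)) (sym (+-assoc (f x) _ _))
  ... | no  _ = trans (cong (f x +_) (∑-partition P? xs f)) (+-exchange (f x) (∑ (filter P? xs) f) _)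

  ∑-map : (g : A → B) (xs : List A) (f : B → ℕ) → ∑ (map g xs) f ≡ ∑[ x ∈ xs ] f (g x)
  ∑-map g []       f = refl
  ∑-map g (x ∷ xs) f = cong (f (g x) +_) (∑-map g xs f)

  ∑-swap : (xs : List A) (ys : List B) (f : A → B → ℕ) →
           ∑[ x ∈ xs ] ∑[ y ∈ ys ] f x y ≡ ∑[ y ∈ ys ] ∑[ x ∈ xs ] f x y
  ∑-swap []       ys f = sym (∑-zero ys (λ _ → refl))
  ∑-swap (x ∷ xs) ys f = trans (cong (∑ ys (f x) +_) (∑-swap xs ys f))
                               (sym (∑-distrib-+ ys (f x) (λ y → ∑[ x ∈ xs ] f x y)))

  ∑-cartesianProductWith : (_⊗_ : A → B → C) (xs : List A) (ys : List B) (f : C → ℕ) →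
    ∑ (cartesianProductWith _⊗_ xs ys) f ≡ ∑[ x ∈ xs ] ∑[ y ∈ ys ] f (x ⊗ y)
  ∑-cartesianProductWith _⊗_ []       ys f = refl
  ∑-cartesianProductWith _⊗_ (x ∷ xs) ys f = begin
    ∑ (map (x ⊗_) ys ++ cartesianProductWith _⊗_ xs ys) f
      ≡⟨ ∑-++ (map (x ⊗_) ys) _ f ⟩
    ∑ (map (x ⊗_) ys) f + ∑ (cartesianProductWith _⊗_ xs ys) f
      ≡⟨ cong₂ _+_ (∑-map (x ⊗_) ys f) (∑-cartesianProductWith _⊗_ xs ys f) ⟩
    ∑[ y ∈ ys ] f (x ⊗ y) + ∑[ x ∈ xs ] ∑[ y ∈ ys ] f (x ⊗ y) ∎
    where open ≡-Reasoning

  ∑≡length⇒≡1 : ∀ xs {f : A → ℕ} → (∀ {x} → x ∈ xs → 1 ≤ f x) → ∑ xs f ≡ length xs →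
                ∀ {x} → x ∈ xs → f x ≡ 1
  ∑≡length⇒≡1 (y ∷ xs) {f} 1≤f sum≡ x∈ = go x∈
    where
    length≤∑ : length xs ≤ ∑ xs f
    length≤∑ = subst (_≤ ∑ xs f) (∑-length xs) (∑-mono-≤ xs (1≤f ∘ there))
    fy≤1 : f y ≤ 1
    fy≤1 = +-cancelʳ-≤ (length xs) (f y) 1 (≤-trans (+-monoʳ-≤ (f y) length≤∑) (≤-reflexive sum≡))
    ∑≤length : ∑ xs f ≤ length xs
    ∑≤length = +-cancelˡ-≤ 1 _ _ (≤-trans (+-monoˡ-≤ (∑ xs f) (1≤f (here refl))) (≤-reflexive sum≡))
    go : ∀ {x} → x ∈ y ∷ xs → f x ≡ 1
    go (here refl)  = ≤-antisym fy≤1 (1≤f (here refl))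
    go (there x∈xs) = ∑≡length⇒≡1 xs (1≤f ∘ there) (≤-antisym ∑≤length length≤∑) x∈xs

  unique-↭ : ∀ {xs ys : List A} → Unique xs → Unique ys → (∀ {x} → x ∈ xs ⇔ x ∈ ys) → xs ↭ ys
  unique-↭ xs! ys! xs⇔ys = ∼bag⇒↭ (unique∧set⇒bag xs! ys! xs⇔ys)

  ∑-unique-cong : ∀ {xs ys} (f : A → ℕ) → Unique xs → Unique ys → (∀ {x} → x ∈ xs ⇔ x ∈ ys) →
                  ∑ xs f ≡ ∑ ys f
  ∑-unique-cong f xs! ys! xs⇔ys = ∑-↭ f (unique-↭ xs! ys! xs⇔ys)

  module _ {A : Set} (_≟_ : DecidableEquality A) where

    ∑-𝟙-∉ : ∀ {x xs} → x ∉ xs → ∑[ y ∈ xs ] 𝟙 (x ≟ y) ≡ 0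
    ∑-𝟙-∉ {x} {xs} x∉xs = ∑-zero xs (λ {y} y∈xs → 𝟙-no (x ≟ y) (λ { refl → x∉xs y∈xs }))

    ∑-𝟙-∈ : ∀ {x xs} → Unique xs → x ∈ xs → ∑[ y ∈ xs ] 𝟙 (x ≟ y) ≡ 1
    ∑-𝟙-∈ {x} {x ∷ xs} x∷xs! (here refl) =
      cong₂ _+_ (𝟙-yes (x ≟ x) refl) (∑-𝟙-∉ (Unique[x∷xs]⇒x∉xs x∷xs!))
    ∑-𝟙-∈ {x} {y ∷ xs} y∷xs!@(_ ∷ xs!) (there x∈xs) =
      cong₂ _+_ (𝟙-no (x ≟ y) (λ { refl → Unique[x∷xs]⇒x∉xs y∷xs! x∈xs })) (∑-𝟙-∈ xs! x∈xs)

    unique-⊆⇒length-≤ : ∀ {xs ys} → Unique xs → Unique ys → (∀ {x} → x ∈ xs → x ∈ ys) →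
                        length xs ≤ length ys
    unique-⊆⇒length-≤ {xs} {ys} xs! ys! xs⊆ys = begin
      length xs               ≡⟨ ↭-length (unique-↭ xs! (unique-filter⁺ (_∈? xs) ys!) xs⇔ys∩xs) ⟩
      length (filter (_∈? xs) ys) ≤⟨ length-filter (_∈? xs) ys ⟩
      length ys               ∎
      where
      open ≤-Reasoning
      open DecMembership _≟_ using (_∈?_)
      xs⇔ys∩xs : ∀ {x} → x ∈ xs ⇔ x ∈ filter (_∈? xs) ys
      xs⇔ys∩xs = mk⇔ (λ x∈xs → ∈-filter⁺ (_∈? xs) (xs⊆ys x∈xs) x∈xs)
                     (proj₂ ∘ ∈-filter⁻ (_∈? xs) {xs = ys})

  unique-<⇒length-≤ : ∀ {xs k} → Unique xs → (∀ {x} → x ∈ xs → x < k) → length xs ≤ k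
  unique-<⇒length-≤ {xs} {k} xs! xs<k =
    subst (length xs ≤_) (length-upTo k) (unique-⊆⇒length-≤ ℕ._≟_ xs! (upTo⁺ k) (∈-upTo⁺ ∘ xs<k))

  map⁺-injectiveOn : ∀ (f : A → B) {xs} → Unique xs →
                     (∀ {x y} → x ∈ xs → y ∈ xs → f x ≡ f y → x ≡ y) → Unique (map f xs)
  map⁺-injectiveOn f {[]}     _                 _   = []
  map⁺-injectiveOn f {x ∷ xs} x∷xs!@(_ ∷ xs!) inj =
    All.map⁺ (All.tabulate λ y∈xs fx≡fy →
      Unique[x∷xs]⇒x∉xs x∷xs! (subst (_∈ xs) (sym (inj (here refl) (there y∈xs) fx≡fy)) y∈xs))
    ∷ map⁺-injectiveOn f xs! (λ x∈ y∈ → inj (there x∈) (there y∈))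

  iterate-+ : ∀ (f : A → A) x m n → iterate f x (m + n) ≡ iterate f (iterate f x m) n
  iterate-+ f x zero    n = refl
  iterate-+ f x (suc m) n = iterate-+ f (f x) m n

  iterate-suc : ∀ (f : A → A) x n → iterate f x (suc n) ≡ f (iterate f x n)
  iterate-suc f x zero    = refl
  iterate-suc f x (suc n) = iterate-suc f (f x) n

  iterate-fixed : ∀ (f : A → A) {x} n → f x ≡ x → iterate f x n ≡ x
  iterate-fixed f zero    fx≡x = refl
  iterate-fixed f (suc n) fx≡x = trans (cong (λ y → iterate f y n) fx≡x) (iterate-fixed f n fx≡x)

  iterate-* : ∀ (f : A → A) {x} k d → iterate f x d ≡ x → iterate f x (k * d) ≡ x
  iterate-* f     zero    d f^d≡id = refl
  iterate-* f {x} (suc k) d f^d≡id = begin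
    iterate f x (d + k * d)             ≡⟨ iterate-+ f x d (k * d) ⟩
    iterate f (iterate f x d) (k * d)   ≡⟨ cong (λ y → iterate f y (k * d)) f^d≡id ⟩
    iterate f x (k * d)                 ≡⟨ iterate-* f k d f^d≡id ⟩
    x                                   ∎
    where open ≡-Reasoning

  iterate-invariant : ∀ (f : A → A) (w : A → B) → (∀ x → w (f x) ≡ w x) → ∀ x n → w (iterate f x n) ≡ w x
  iterate-invariant f w w-inv x zero    = refl
  iterate-invariant f w w-inv x (suc n) = trans (iterate-invariant f w w-inv (f x) n) (w-inv x)

  iterate-preserves : ∀ (f : A → A) {P : A → Set} → (∀ {x} → P x → P (f x)) → ∀ {x} n → P x → P (iterate f x n)
  iterate-preserves f f-pres zero    px = px
  iterate-preserves f {P} f-pres (suc n) px = iterate-preserves f {P} f-pres n (f-pres px)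

  consecutive-periods⇒fixed : ∀ (f : A → A) {x} i → iterate f x i ≡ x → iterate f x (1 + i) ≡ x → f x ≡ x
  consecutive-periods⇒fixed f {x} i f^i≡id f^1+i≡id = begin
    f x                  ≡⟨ cong f f^i≡id ⟨
    f (iterate f x i)    ≡⟨ iterate-suc f x i ⟨
    iterate f x (1 + i)  ≡⟨ f^1+i≡id ⟩
    x                    ∎
    where open ≡-Reasoning

  -- Bézout for the coprime pair (ℓ, d) yields two consecutive multiples of d and ℓ.
  prime-period⇒fixed : ∀ (f : A → A) {x ℓ d} → Prime ℓ → 0 < d → d < ℓ →
                       iterate f x d ≡ x → iterate f x ℓ ≡ x → f x ≡ x
  prime-period⇒fixed f {x} {ℓ} {d} ℓ-prime 0<d d<ℓ f^d≡id f^ℓ≡id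
    with coprime-Bézout (prime⇒coprime ℓ-prime {{>-nonZero 0<d}} d<ℓ)
  ... | GCD.Bézout.+- a b 1+bd≡aℓ = consecutive-periods⇒fixed f (b * d) (iterate-* f b d f^d≡id)
          (trans (cong (iterate f x) 1+bd≡aℓ) (iterate-* f a ℓ f^ℓ≡id))
  ... | GCD.Bézout.-+ a b 1+aℓ≡bd = consecutive-periods⇒fixed f (a * ℓ) (iterate-* f a ℓ f^ℓ≡id)
          (trans (cong (iterate f x) 1+aℓ≡bd) (iterate-* f b d f^d≡id))

  module Necklace {V : Set} (_≟_ : DecidableEquality V) (σ : V → V) {ℓ} (ℓ-prime : Prime ℓ) where

    open DecMembership _≟_ using (_∈?_)

    fixed? : ∀ x → Dec (σ x ≡ x)
    fixed? x = σ x ≟ x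

    Periodic : V → Set
    Periodic x = iterate σ x ℓ ≡ x

    orbit : V → List V
    orbit x = applyUpTo (iterate σ x) ℓ

    private
      ℓ≡1+pred-ℓ : ℓ ≡ suc (pred ℓ)
      ℓ≡1+pred-ℓ = sym (suc-pred ℓ {{prime⇒nonZero ℓ-prime}})

    x∈orbit : ∀ x → x ∈ orbit x
    x∈orbit x = ∈-applyUpTo⁺ (iterate σ x) (subst (0 <_) (sym ℓ≡1+pred-ℓ) z<s)

    module _ {x} (x-periodic : Periodic x) where

      periodic-iterate : ∀ i → Periodic (iterate σ x i)
      periodic-iterate i = begin
        iterate σ (iterate σ x i) ℓ  ≡⟨ iterate-+ σ x i ℓ ⟨
        iterate σ x (i + ℓ)          ≡⟨ cong (iterate σ x) (+-comm i ℓ) ⟩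
        iterate σ x (ℓ + i)          ≡⟨ iterate-+ σ x ℓ i ⟩
        iterate σ (iterate σ x ℓ) i  ≡⟨ cong (λ y → iterate σ y i) x-periodic ⟩
        iterate σ x i                ∎
        where open ≡-Reasoning

      fixed-iterate⇒fixed : ∀ i → i ≤ ℓ → σ (iterate σ x i) ≡ iterate σ x i → σ x ≡ x
      fixed-iterate⇒fixed i i≤ℓ y-fixed = subst (λ z → σ z ≡ z) y≡x y-fixed
        where
        y≡x : iterate σ x i ≡ x
        y≡x = begin
          iterate σ x i                          ≡⟨ iterate-fixed σ (ℓ ∸ i) y-fixed ⟨
          iterate σ (iterate σ x i) (ℓ ∸ i)      ≡⟨ iterate-+ σ x i (ℓ ∸ i) ⟨
          iterate σ x (i + (ℓ ∸ i))              ≡⟨ cong (iterate σ x) (m+[n∸m]≡n i≤ℓ) ⟩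
          iterate σ x ℓ                          ≡⟨ x-periodic ⟩
          x                                      ∎
          where open ≡-Reasoning

      fixed∈orbit⇒fixed : ∀ {y} → y ∈ orbit x → σ y ≡ y → σ x ≡ x
      fixed∈orbit⇒fixed y∈orbit y-fixed with ∈-applyUpTo⁻ (iterate σ x) y∈orbit
      ... | i , i<ℓ , refl = fixed-iterate⇒fixed i (<⇒≤ i<ℓ) y-fixed

      orbit-unique : σ x ≢ x → Unique (orbit x)
      orbit-unique x-moves = applyUpTo⁺₁ (iterate σ x) ℓ distinct
        where
        distinct : ∀ {i j} → i < j → j < ℓ → iterate σ x i ≢ iterate σ x j
        distinct {i} {j} i<j j<ℓ xᵢ≡xⱼ = x-moves (fixed-iterate⇒fixed i (<⇒≤ (<-trans i<j j<ℓ)) xᵢ-fixed)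
          where
          xᵢ-returns : iterate σ (iterate σ x i) (j ∸ i) ≡ iterate σ x i
          xᵢ-returns = trans (sym (iterate-+ σ x i (j ∸ i)))
                             (trans (cong (iterate σ x) (m+[n∸m]≡n (<⇒≤ i<j))) (sym xᵢ≡xⱼ))
          xᵢ-fixed : σ (iterate σ x i) ≡ iterate σ x i
          xᵢ-fixed = prime-period⇒fixed σ ℓ-prime (m<n⇒0<n∸m i<j) (≤-<-trans (m∸n≤m j i) j<ℓ)
                                        xᵢ-returns (periodic-iterate i)

      orbit-closed : ∀ {y} → y ∈ orbit x → σ y ∈ orbit x
      orbit-closed y∈orbit with ∈-applyUpTo⁻ (iterate σ x) y∈orbit
      ... | i , i<ℓ , refl with m≤n⇒m<n∨m≡n i<ℓ
      ...   | inj₁ 1+i<ℓ = subst (_∈ orbit x) (iterate-suc σ x i) (∈-applyUpTo⁺ (iterate σ x) 1+i<ℓ)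
      ...   | inj₂ 1+i≡ℓ = subst (_∈ orbit x)
                              (trans (sym x-periodic) (trans (cong (iterate σ x) (sym 1+i≡ℓ)) (iterate-suc σ x i)))
                              (x∈orbit x)

      ∑-orbit : ∀ (w : V → ℕ) → (∀ y → w (σ y) ≡ w y) → ∑ (orbit x) w ≡ ℓ * w x
      ∑-orbit w w-inv = begin
        ∑ (orbit x) w            ≡⟨ ∑-cong (orbit x) w≡wx ⟩
        ∑[ _ ∈ orbit x ] w x     ≡⟨ ∑-const (orbit x) (w x) ⟩
        length (orbit x) * w x   ≡⟨ cong (_* w x) (length-applyUpTo (iterate σ x) ℓ) ⟩
        ℓ * w x                  ∎
        where
        open ≡-Reasoning
        w≡wx : ∀ {y} → y ∈ orbit x → w y ≡ w x
        w≡wx y∈orbit with ∈-applyUpTo⁻ (iterate σ x) y∈orbit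
        ... | i , _ , refl = iterate-invariant σ w w-inv x i

    Closed : List V → Set
    Closed X = ∀ {x} → x ∈ X → σ x ∈ X

    module RemoveOrbit {X} (X! : Unique X) (closed : Closed X) (periodic : ∀ {x} → x ∈ X → Periodic x)
                       {x} (x∈X : x ∈ X) (x-moves : σ x ≢ x) where

      rest : List V
      rest = filter (¬? ∘ (_∈? orbit x)) X

      rest⊆X : ∀ {y} → y ∈ rest → y ∈ X
      rest⊆X = proj₁ ∘ ∈-filter⁻ (¬? ∘ (_∈? orbit x)) {xs = X}

      rest-unique : Unique rest
      rest-unique = unique-filter⁺ (¬? ∘ (_∈? orbit x)) X!

      rest-shorter : length rest < length X
      rest-shorter = filter-notAll (¬? ∘ (_∈? orbit x)) X (lose x∈X (λ x∉orbit → x∉orbit (x∈orbit x)))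

      -- σ y ∈ orbit x would put y = σ^(ℓ-1) (σ y) in the orbit as well.
      rest-closed : Closed rest
      rest-closed {y} y∈rest = ∈-filter⁺ (¬? ∘ (_∈? orbit x)) (closed y∈X) σy∉orbit
        where
        y∈X : y ∈ X
        y∈X = rest⊆X y∈rest
        σy∉orbit : σ y ∉ orbit x
        σy∉orbit σy∈orbit = proj₂ (∈-filter⁻ (¬? ∘ (_∈? orbit x)) {xs = X} y∈rest)
          (subst (_∈ orbit x) (trans (cong (iterate σ y) (sym ℓ≡1+pred-ℓ)) (periodic y∈X))
            (iterate-preserves σ {_∈ orbit x} (orbit-closed (periodic x∈X)) (pred ℓ) σy∈orbit))

      ∑-remove-orbit : ∀ w → (∀ y → w (σ y) ≡ w y) → ∑ X w ≡ ℓ * w x + ∑ rest w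
      ∑-remove-orbit w w-inv = trans (∑-partition (_∈? orbit x) X w) (cong (_+ ∑ rest w) ∑-orbit-part)
        where
        orbit-part⇔orbit : ∀ {y} → y ∈ filter (_∈? orbit x) X ⇔ y ∈ orbit x
        orbit-part⇔orbit = mk⇔ (proj₂ ∘ ∈-filter⁻ (_∈? orbit x) {xs = X}) λ y∈orbit →
          ∈-filter⁺ (_∈? orbit x) (orbit⊆X y∈orbit) y∈orbit
          where
          orbit⊆X : ∀ {y} → y ∈ orbit x → y ∈ X
          orbit⊆X y∈orbit with ∈-applyUpTo⁻ (iterate σ x) y∈orbit
          ... | i , _ , refl = iterate-preserves σ {_∈ X} closed i x∈X
        ∑-orbit-part : ∑ (filter (_∈? orbit x) X) w ≡ ℓ * w x
        ∑-orbit-part = trans (∑-unique-cong w (unique-filter⁺ (_∈? orbit x) X!) (orbit-unique (periodic x∈X) x-moves)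
                                            orbit-part⇔orbit)
                             (∑-orbit (periodic x∈X) w w-inv)

      ∑-fixed-rest : ∀ w → ∑ (filter fixed? rest) w ≡ ∑ (filter fixed? X) w
      ∑-fixed-rest w = ∑-unique-cong w (unique-filter⁺ fixed? rest-unique) (unique-filter⁺ fixed? X!) (mk⇔ to from)
        where
        fixed∉orbit : ∀ {y} → σ y ≡ y → y ∉ orbit x
        fixed∉orbit y-fixed y∈orbit = x-moves (fixed∈orbit⇒fixed (periodic x∈X) y∈orbit y-fixed)
        to : ∀ {y} → y ∈ filter fixed? rest → y ∈ filter fixed? X
        to y∈ with y∈rest , y-fixed ← ∈-filter⁻ fixed? {xs = rest} y∈ = ∈-filter⁺ fixed? (rest⊆X y∈rest) y-fixed
        from : ∀ {y} → y ∈ filter fixed? X → y ∈ filter fixed? rest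
        from y∈ with y∈X , y-fixed ← ∈-filter⁻ fixed? {xs = X} y∈ =
          ∈-filter⁺ fixed? (∈-filter⁺ (¬? ∘ (_∈? orbit x)) y∈X (fixed∉orbit y-fixed)) y-fixed

    module _ (w : V → ℕ) (w-inv : ∀ x → w (σ x) ≡ w x) where

      necklace-congruence : ∀ X → Unique X → Closed X → (∀ {x} → x ∈ X → Periodic x) →
                            ∃[ k ] ∑ X w ≡ ∑ (filter fixed? X) w + k * ℓ
      necklace-congruence X = go X (<-wellFounded (length X))
        where
        go : ∀ X → Acc _<_ (length X) → Unique X → Closed X → (∀ {x} → x ∈ X → Periodic x) →
             ∃[ k ] ∑ X w ≡ ∑ (filter fixed? X) w + k * ℓ
        go X _ X! closed periodic with All.all? fixed? X
        ... | yes all-fixed = 0 , sym (trans (+-identityʳ _) (cong (λ Y → ∑ Y w) (filter-all fixed? all-fixed)))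
        go X (acc rec) X! closed periodic | no ¬all-fixed
          with x , x∈X , x-moves ← find (All.¬All⇒Any¬ fixed? X ¬all-fixed) = w x + k , (begin
            ∑ X w                                         ≡⟨ ∑-remove-orbit w w-inv ⟩
            ℓ * w x + ∑ rest w                            ≡⟨ cong (ℓ * w x +_) ∑rest≡ ⟩
            ℓ * w x + (∑ (filter fixed? rest) w + k * ℓ)  ≡⟨ cong (λ t → ℓ * w x + (t + k * ℓ)) (∑-fixed-rest w) ⟩
            ℓ * w x + (∑ (filter fixed? X) w + k * ℓ)     ≡⟨ rearrange ℓ (w x) (∑ (filter fixed? X) w) k ⟩
            ∑ (filter fixed? X) w + (w x + k) * ℓ         ∎)
          where
          open ≡-Reasoning
          open RemoveOrbit X! closed periodic x∈X x-moves
          rearrange : ∀ l a b k → l * a + (b + k * l) ≡ b + (a + k) * l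
          rearrange = solve-∀
          IH : ∃[ k ] ∑ rest w ≡ ∑ (filter fixed? rest) w + k * ℓ
          IH = go rest (rec rest-shorter) rest-unique rest-closed (periodic ∘ rest⊆X)
          k : ℕ
          k = proj₁ IH
          ∑rest≡ : ∑ rest w ≡ ∑ (filter fixed? rest) w + k * ℓ
          ∑rest≡ = proj₂ IH

  tuples : List A → ℕ → List (List A)
  tuples xs zero    = [ [] ]
  tuples xs (suc k) = cartesianProductWith _∷_ xs (tuples xs k)

  ∈-tuples⁻ : ∀ xs k {u : List A} → u ∈ tuples xs k → length u ≡ k × All.All (_∈ xs) u
  ∈-tuples⁻ xs zero    (here refl) = refl , All.[]
  ∈-tuples⁻ xs (suc k) u∈
    with a , v , a∈xs , v∈ , refl ← ∈-cartesianProductWith⁻ _∷_ xs (tuples xs k) u∈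
    with |v|≡k , v⊆xs ← ∈-tuples⁻ xs k v∈ = cong suc |v|≡k , a∈xs All.∷ v⊆xs

  ∈-tuples⁺ : ∀ {xs u : List A} → All.All (_∈ xs) u → u ∈ tuples xs (length u)
  ∈-tuples⁺ All.[]           = here refl
  ∈-tuples⁺ (a∈xs All.∷ u⊆xs) = ∈-cartesianProductWith⁺ _∷_ a∈xs (∈-tuples⁺ u⊆xs)

  tuples-unique : ∀ {xs : List A} → Unique xs → ∀ k → Unique (tuples xs k)
  tuples-unique xs! zero    = All.[] ∷ []
  tuples-unique xs! (suc k) = cartesianProductWith⁺ _∷_ ∷-injective xs! (tuples-unique xs! k)

  length-tuples : ∀ (xs : List A) k → length (tuples xs k) ≡ length xs ^ k
  length-tuples xs zero    = refl
  length-tuples xs (suc k) = begin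
    length (tuples xs (suc k))                 ≡⟨ ∑-length (tuples xs (suc k)) ⟨
    ∑[ _ ∈ tuples xs (suc k) ] 1               ≡⟨ ∑-cartesianProductWith _∷_ xs (tuples xs k) (λ _ → 1) ⟩
    ∑[ _ ∈ xs ] ∑[ _ ∈ tuples xs k ] 1         ≡⟨ ∑-const xs _ ⟩
    length xs * ∑[ _ ∈ tuples xs k ] 1         ≡⟨ cong (length xs *_) (trans (∑-length (tuples xs k)) (length-tuples xs k)) ⟩
    length xs * length xs ^ k                  ∎
    where open ≡-Reasoning

  rotate : List A → List A
  rotate []       = []
  rotate (x ∷ xs) = xs ++ [ x ]

  iterate-rotate-++ : ∀ (xs ys : List A) → iterate rotate (xs ++ ys) (length xs) ≡ ys ++ xs
  iterate-rotate-++ []       ys = sym (++-identityʳ ys)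
  iterate-rotate-++ (x ∷ xs) ys = begin
    iterate rotate ((xs ++ ys) ++ [ x ]) (length xs) ≡⟨ cong (λ zs → iterate rotate zs (length xs)) (++-assoc xs ys [ x ]) ⟩
    iterate rotate (xs ++ (ys ++ [ x ])) (length xs) ≡⟨ iterate-rotate-++ xs (ys ++ [ x ]) ⟩
    (ys ++ [ x ]) ++ xs                              ≡⟨ ++-assoc ys [ x ] xs ⟩
    ys ++ x ∷ xs                                     ∎
    where open ≡-Reasoning

  iterate-rotate-length : ∀ (u : List A) → iterate rotate u (length u) ≡ u
  iterate-rotate-length u = subst (λ v → iterate rotate v (length u) ≡ u) (++-identityʳ u) (iterate-rotate-++ u [])

  rotate-preserves-length : ∀ (u : List A) → length (rotate u) ≡ length u
  rotate-preserves-length []       = refl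
  rotate-preserves-length (x ∷ xs) = trans (length-++ xs) (+-comm (length xs) 1)

  rotate-preserves-All : ∀ {P : A → Set} {u} → All.All P u → All.All P (rotate u)
  rotate-preserves-All All.[]         = All.[]
  rotate-preserves-All (px All.∷ pxs) = All.++⁺ pxs (px All.∷ All.[])

  rotate-replicate : ∀ k (a : A) → rotate (replicate k a) ≡ replicate k a
  rotate-replicate zero    a = refl
  rotate-replicate (suc k) a = snoc-replicate k
    where
    snoc-replicate : ∀ k → replicate k a ++ [ a ] ≡ a ∷ replicate k a
    snoc-replicate zero    = refl
    snoc-replicate (suc k) = cong (a ∷_) (snoc-replicate k)

  rotate-fixed⇒replicate : ∀ (x : A) xs → rotate (x ∷ xs) ≡ x ∷ xs → x ∷ xs ≡ replicate (suc (length xs)) x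
  rotate-fixed⇒replicate x xs fixed = cong (x ∷_) (go xs fixed)
    where
    go : ∀ xs → xs ++ [ x ] ≡ x ∷ xs → xs ≡ replicate (length xs) x
    go []       _  = refl
    go (y ∷ ys) eq with refl , eq′ ← ∷-injective eq = cong (x ∷_) (go ys eq′)

  module _ (_≟_ : DecidableEquality (List A)) {xs : List A} (k : ℕ) where

    rotation-fixed-tuples⇔replicate : ∀ {u} →
      u ∈ filter (λ v → rotate v ≟ v) (tuples xs (suc k)) ⇔ u ∈ map (replicate (suc k)) xs
    rotation-fixed-tuples⇔replicate = mk⇔ to from
      where
      to : ∀ {u} → u ∈ filter (λ v → rotate v ≟ v) (tuples xs (suc k)) → u ∈ map (replicate (suc k)) xs
      to {[]} u∈ with u∈tuples , _ ← ∈-filter⁻ (λ v → rotate v ≟ v) {xs = tuples xs (suc k)} u∈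
        with () ← proj₁ (∈-tuples⁻ xs (suc k) u∈tuples)
      to {a ∷ u} u∈ with u∈tuples , fixed ← ∈-filter⁻ (λ v → rotate v ≟ v) {xs = tuples xs (suc k)} u∈
        with |u|≡k , a∈xs All.∷ _ ← ∈-tuples⁻ xs (suc k) u∈tuples =
        subst (_∈ map (replicate (suc k)) xs)
              (sym (trans (rotate-fixed⇒replicate a u fixed) (cong (λ l → replicate l a) |u|≡k)))
              (∈-map⁺ (replicate (suc k)) a∈xs)
      from : ∀ {u} → u ∈ map (replicate (suc k)) xs → u ∈ filter (λ v → rotate v ≟ v) (tuples xs (suc k))
      from u∈ with a , a∈xs , refl ← ∈-map⁻ (replicate (suc k)) u∈ =
        ∈-filter⁺ (λ v → rotate v ≟ v) replicate∈tuples (rotate-replicate (suc k) a)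
        where
        replicate∈tuples : replicate (suc k) a ∈ tuples xs (suc k)
        replicate∈tuples = subst (λ l → replicate (suc k) a ∈ tuples xs l) (length-replicate (suc k))
                             (∈-tuples⁺ (All.replicate⁺ (suc k) a∈xs))

  prime∣^⇒∣ : ∀ {p m} k → Prime p → p ∣ m ^ k → p ∣ m
  prime∣^⇒∣ zero        p-prime p∣1 = ⊥-elim (¬prime[1] (subst Prime (∣1⇒≡1 p∣1) p-prime))
  prime∣^⇒∣ {m = m} (suc k) p-prime p∣m^[1+k] with euclidsLemma m (m ^ k) p-prime p∣m^[1+k]
  ... | inj₁ p∣m   = p∣m
  ... | inj₂ p∣m^k = prime∣^⇒∣ k p-prime p∣m^k

  module Tiling {G : Set} {mul : Op₂ G} {ε : G} {inv : Op₁ G} (isAbelianGroup : IsAbelianGroup _≡_ mul ε inv)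
                (decEq : DecidableEquality G) {elements : List G} (elements! : Unique elements)
                (∈-elements : ∀ g → g ∈ elements) where

    infix  4 _≟_
    infixl 7 _∙_
    infix  8 _⁻¹

    private
      _≟_ : DecidableEquality G
      _≟_ = decEq

      _∙_ : Op₂ G
      _∙_ = mul

      _⁻¹ : Op₁ G
      _⁻¹ = inv

    open IsAbelianGroup isAbelianGroup using (isGroup; isCommutativeSemigroup; comm)

    private
      group : Group 0ℓ 0ℓ
      group = record { isGroup = isGroup }

      commutativeSemigroup : CommutativeSemigroup 0ℓ 0ℓ
      commutativeSemigroup = record { isCommutativeSemigroup = isCommutativeSemigroup }

    open import Algebra.Properties.Group group
      using (∙-cancelˡ; ∙-cancelʳ; y≈x\\z; \\-leftDividesˡ; ⁻¹-involutive; ⁻¹-injective)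
    open import Algebra.Properties.CommutativeSemigroup commutativeSemigroup
      using (x∙yz≈y∙xz; xy∙z≈y∙xz)
    open import Algebra.Definitions.RawMonoid (Group.rawMonoid group) public using () renaming (_×_ to _·_)

    ∙-solve : ∀ x y z → x ∙ y ≡ z ⇔ y ≡ x ⁻¹ ∙ z
    ∙-solve x y z = mk⇔ (y≈x\\z x y z) (λ { refl → \\-leftDividesˡ x z })

    hits : List G → G → G → ℕ
    hits B x g = ∑[ b ∈ B ] 𝟙 (x ∙ b ≟ g)

    reps : List G → List G → G → ℕ
    reps A B g = ∑[ a ∈ A ] hits B a g

    IsTiling : List G → List G → Set
    IsTiling A B = ∀ g → reps A B g ≡ 1

    hits-∙ : ∀ B a x g → hits B (a ∙ x) g ≡ hits B a (x ⁻¹ ∙ g)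
    hits-∙ B a x g = ∑-cong B λ {b} _ → 𝟙-cong ((a ∙ x) ∙ b ≟ g) (a ∙ b ≟ x ⁻¹ ∙ g)
      (mk⇔ (λ eq → Equivalence.to (∙-solve x (a ∙ b) g) (trans (sym (xy∙z≈y∙xz a x b)) eq))
           (λ eq → trans (xy∙z≈y∙xz a x b) (Equivalence.from (∙-solve x (a ∙ b) g) eq)))

    1≤hits : ∀ {B x b g} → b ∈ B → x ∙ b ≡ g → 1 ≤ hits B x g
    1≤hits {B} {x} {b} {g} b∈B xb≡g =
      subst (_≤ hits B x g) (𝟙-yes (x ∙ b ≟ g) xb≡g) (∈⇒≤∑ (λ b → 𝟙 (x ∙ b ≟ g)) b∈B)

    ∑-reps : ∀ A B → ∑ elements (reps A B) ≡ length A * length B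
    ∑-reps A B = begin
      ∑[ g ∈ elements ] ∑[ a ∈ A ] ∑[ b ∈ B ] 𝟙 (a ∙ b ≟ g)
        ≡⟨ ∑-swap elements A _ ⟩
      ∑[ a ∈ A ] ∑[ g ∈ elements ] ∑[ b ∈ B ] 𝟙 (a ∙ b ≟ g)
        ≡⟨ ∑-cong A (λ {a} _ → ∑-swap elements B _) ⟩
      ∑[ a ∈ A ] ∑[ b ∈ B ] ∑[ g ∈ elements ] 𝟙 (a ∙ b ≟ g)
        ≡⟨ ∑-cong A (λ {a} _ → ∑-cong B λ {b} _ → ∑-𝟙-∈ _≟_ elements! (∈-elements (a ∙ b))) ⟩
      ∑[ a ∈ A ] ∑[ b ∈ B ] 1
        ≡⟨ ∑-cong A (λ _ → ∑-length B) ⟩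
      ∑[ a ∈ A ] length B
        ≡⟨ ∑-const A (length B) ⟩
      length A * length B
        ∎
      where open ≡-Reasoning

    tiling-size : ∀ {A B} → IsTiling A B → length A * length B ≡ length elements
    tiling-size {A} {B} A⊕B = trans (sym (∑-reps A B)) (trans (∑-cong elements (λ {g} _ → A⊕B g)) (∑-length elements))

    reps≤1⇒unique : ∀ {A B b} → (∀ g → reps A B g ≤ 1) → b ∈ B → Unique A
    reps≤1⇒unique {[]}    _       _   = []
    reps≤1⇒unique {x ∷ A} {B} {b} reps≤1 b∈B =
      All.¬Any⇒All¬ A x∉A ∷ reps≤1⇒unique (λ g → ≤-trans (m≤n+m (reps A B g) (hits B x g)) (reps≤1 g)) b∈B
      where
      x∉A : x ∉ A
      x∉A x∈A = <⇒≱ (+-mono-≤ (1≤hits b∈B refl)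
                               (≤-trans (1≤hits b∈B refl) (∈⇒≤∑ (λ a → hits B a (x ∙ b)) x∈A)))
                    (reps≤1 (x ∙ b))

    tiling⇒unique : ∀ {A B b} → IsTiling A B → b ∈ B → Unique A
    tiling⇒unique A⊕B = reps≤1⇒unique (≤-reflexive ∘ A⊕B)

    tiling⇒translates-unique : ∀ {A B s s′} → IsTiling A B → Unique A → s ∈ B → s′ ∈ B → s ≢ s′ →
                               Unique (map (s ∙_) A ++ map (s′ ∙_) A)
    tiling⇒translates-unique {A} {B} {s} {s′} A⊕B A! s∈B s′∈B s≢s′ =
      unique-++⁺ (unique-map⁺ (∙-cancelˡ s _ _) A!) (unique-map⁺ (∙-cancelˡ s′ _ _) A!) disjoint
      where
      disjoint : ∀ {g} → g ∈ map (s ∙_) A × g ∈ map (s′ ∙_) A → ⊥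
      disjoint (g∈sA , g∈s′A)
        with a , a∈A , refl ← ∈-map⁻ (s ∙_) g∈sA | a′ , a′∈A , sa≡s′a′ ← ∈-map⁻ (s′ ∙_) g∈s′A
        with a ≟ a′
      ... | yes refl = s≢s′ (∙-cancelʳ a s s′ sa≡s′a′)
      ... | no a≢a′  = <⇒≱ (≤-trans (+-mono-≤ (1≤hits s∈B (comm a s))
                                              (1≤hits s′∈B (trans (comm a′ s′) (sym sa≡s′a′))))
                                    (≢-∈⇒+≤∑ (λ x → hits B x (s ∙ a)) a∈A a′∈A a≢a′))
                           (≤-reflexive (A⊕B (s ∙ a)))

    ⁻¹∙-solve : ∀ c b g → c ⁻¹ ∙ b ≡ g ⇔ g ∙ c ≡ b
    ⁻¹∙-solve c b g = mk⇔ (λ eq → sym (trans (Equivalence.to (∙-solve (c ⁻¹) b g) eq) c⁻¹⁻¹g≡gc))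
                           (λ eq → Equivalence.from (∙-solve (c ⁻¹) b g) (trans (sym eq) (sym c⁻¹⁻¹g≡gc)))
      where
      c⁻¹⁻¹g≡gc : c ⁻¹ ⁻¹ ∙ g ≡ g ∙ c
      c⁻¹⁻¹g≡gc = trans (cong (_∙ g) (⁻¹-involutive c)) (comm c g)

    unique-completion⇒tiling : ∀ {B C} → Unique B → Unique C →
      (∀ g → ∃[ c ] c ∈ C × g ∙ c ∈ B × (∀ {c′} → c′ ∈ C → g ∙ c′ ∈ B → c′ ≡ c)) →
      IsTiling (map _⁻¹ C) B
    unique-completion⇒tiling {B} {C} B! C! completion g with c₀ , c₀∈C , gc₀∈B , c₀-unique ← completion g = begin
      reps (map _⁻¹ C) B g          ≡⟨ ∑-map _⁻¹ C (λ a → hits B a g) ⟩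
      ∑[ c ∈ C ] hits B (c ⁻¹) g    ≡⟨ ∑-cong C hits≡ ⟩
      ∑[ c ∈ C ] 𝟙 (c₀ ≟ c)         ≡⟨ ∑-𝟙-∈ _≟_ C! c₀∈C ⟩
      1                             ∎
      where
      open ≡-Reasoning
      hits≡ : ∀ {c} → c ∈ C → hits B (c ⁻¹) g ≡ 𝟙 (c₀ ≟ c)
      hits≡ {c} c∈C =
        trans (∑-cong B λ {b} _ → 𝟙-cong (c ⁻¹ ∙ b ≟ g) (g ∙ c ≟ b) (⁻¹∙-solve c b g)) (count c∈C)
        where
        count : ∀ {c} → c ∈ C → ∑[ b ∈ B ] 𝟙 (g ∙ c ≟ b) ≡ 𝟙 (c₀ ≟ c)
        count {c} c∈C with c₀ ≟ c
        ... | yes refl = ∑-𝟙-∈ _≟_ B! gc₀∈B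
        ... | no c₀≢c  = ∑-𝟙-∉ _≟_ (λ gc∈B → c₀≢c (sym (c₀-unique c∈C gc∈B)))

    map-⁻¹-unique : ∀ {C} → Unique C → Unique (map _⁻¹ C)
    map-⁻¹-unique = unique-map⁺ ⁻¹-injective

    ∏ : List G → G
    ∏ = foldr _∙_ ε

    ∏-replicate : ∀ k a → ∏ (replicate k a) ≡ k · a
    ∏-replicate zero    a = refl
    ∏-replicate (suc k) a = cong (a ∙_) (∏-replicate k a)

    ∏-rotate : ∀ u → ∏ (rotate u) ≡ ∏ u
    ∏-rotate []       = refl
    ∏-rotate (x ∷ xs) = ∏-snoc xs
      where
      ∏-snoc : ∀ ys → ∏ (ys ++ [ x ]) ≡ x ∙ ∏ ys
      ∏-snoc []       = refl
      ∏-snoc (y ∷ ys) = trans (cong (y ∙_) (∏-snoc ys)) (x∙yz≈y∙xz y x (∏ ys))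

    module _ {A B} (A⊕B : IsTiling A B) where

      ∑-tuples-hits : ∀ k g → ∑[ u ∈ tuples A (suc k) ] hits B (∏ u) g ≡ length A ^ k
      ∑-tuples-hits k g = begin
        ∑[ u ∈ tuples A (suc k) ] hits B (∏ u) g
          ≡⟨ ∑-cartesianProductWith _∷_ A (tuples A k) _ ⟩
        ∑[ a ∈ A ] ∑[ u ∈ tuples A k ] hits B (a ∙ ∏ u) g
          ≡⟨ ∑-cong A (λ {a} _ → ∑-cong (tuples A k) λ {u} _ → hits-∙ B a (∏ u) g) ⟩
        ∑[ a ∈ A ] ∑[ u ∈ tuples A k ] hits B a (∏ u ⁻¹ ∙ g)
          ≡⟨ ∑-swap A (tuples A k) _ ⟩
        ∑[ u ∈ tuples A k ] reps A B (∏ u ⁻¹ ∙ g)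
          ≡⟨ ∑-cong (tuples A k) (λ {u} _ → A⊕B (∏ u ⁻¹ ∙ g)) ⟩
        ∑[ u ∈ tuples A k ] 1
          ≡⟨ trans (∑-length (tuples A k)) (length-tuples A k) ⟩
        length A ^ k
          ∎
        where open ≡-Reasoning

      -- Count the tuples (a₁,…,a_ℓ) ∈ Aˡ and b ∈ B with a₁ ∙ ⋯ ∙ a_ℓ ∙ b = g: cyclic rotation preserves
      -- the product, and its fixed points are the constant tuples, which contribute the tiling by ℓ·A.
      reps-congruence : Unique A → ∀ {k} → Prime (suc k) → ∀ g →
                        ∃[ j ] length A ^ k ≡ reps (map (suc k ·_) A) B g + j * suc k
      reps-congruence A! {k} ℓ-prime g = j , (begin
          length A ^ k                                             ≡⟨ ∑-tuples-hits k g ⟨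
          ∑ (tuples A (suc k)) W                                   ≡⟨ proj₂ necklace ⟩
          ∑ (filter fixed? (tuples A (suc k))) W + j * suc k       ≡⟨ cong (_+ j * suc k) ∑-fixed ⟩
          reps (map (suc k ·_) A) B g + j * suc k                  ∎)
        where
        open ≡-Reasoning
        open Necklace (≡-dec _≟_) rotate ℓ-prime
        W : List G → ℕ
        W u = hits B (∏ u) g
        closed : Closed (tuples A (suc k))
        closed {u} u∈ with |u|≡ , u⊆A ← ∈-tuples⁻ A (suc k) u∈ =
          subst (λ l → rotate u ∈ tuples A l) (trans (rotate-preserves-length u) |u|≡) (∈-tuples⁺ (rotate-preserves-All u⊆A))
        periodic : ∀ {u} → u ∈ tuples A (suc k) → Periodic u
        periodic {u} u∈ = subst (λ l → iterate rotate u l ≡ u) (proj₁ (∈-tuples⁻ A (suc k) u∈)) (iterate-rotate-length u)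
        necklace : ∃[ j ] ∑ (tuples A (suc k)) W ≡ ∑ (filter fixed? (tuples A (suc k))) W + j * suc k
        necklace = necklace-congruence W (λ u → cong (λ x → hits B x g) (∏-rotate u))
                     (tuples A (suc k)) (tuples-unique A! (suc k)) closed periodic
        j : ℕ
        j = proj₁ necklace
        ∑-fixed : ∑ (filter fixed? (tuples A (suc k))) W ≡ reps (map (suc k ·_) A) B g
        ∑-fixed = begin
          ∑ (filter fixed? (tuples A (suc k))) W
            ≡⟨ ∑-unique-cong W (unique-filter⁺ fixed? (tuples-unique A! (suc k))) (unique-map⁺ ∷-injectiveˡ A!)
                             (rotation-fixed-tuples⇔replicate (≡-dec _≟_) k) ⟩
          ∑ (map (replicate (suc k)) A) W                ≡⟨ ∑-map (replicate (suc k)) A W ⟩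
          ∑[ a ∈ A ] hits B (∏ (replicate (suc k) a)) g
            ≡⟨ ∑-cong A (λ {a} _ → cong (λ x → hits B x g) (∏-replicate (suc k) a)) ⟩
          ∑[ a ∈ A ] hits B (suc k · a) g                ≡⟨ ∑-map (suc k ·_) A (λ a → hits B a g) ⟨
          reps (map (suc k ·_) A) B g                    ∎

    tijdeman : ∀ {A B ℓ} → IsTiling A B → Unique A → Prime ℓ → ¬ ℓ ∣ length A → IsTiling (map (ℓ ·_) A) B
    tijdeman {ℓ = zero}  _ _ ℓ-prime = ⊥-elim (¬prime[0] ℓ-prime)
    tijdeman {A} {B} {suc k} A⊕B A! ℓ-prime ℓ∤|A| g =
      ∑≡length⇒≡1 elements (λ {g} _ → 1≤reps g) total (∈-elements g)
      where
      1≤reps : ∀ g → 1 ≤ reps (map (suc k ·_) A) B g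
      1≤reps g with j , |A|^k≡ ← reps-congruence {A} {B} A⊕B A! ℓ-prime g =
        n≢0⇒n>0 λ reps≡0 → ℓ∤|A| (prime∣^⇒∣ k ℓ-prime (divides j (trans |A|^k≡ (cong (_+ j * suc k) reps≡0))))
      total : ∑ elements (reps (map (suc k ·_) A) B) ≡ length elements
      total = trans (∑-reps (map (suc k ·_) A) B) (trans (cong (_* length B) (length-map (suc k ·_) A)) (tiling-size {A} {B} A⊕B))

module CyclicGroups where

  open import Defs
  open import Algebra.Structures using (IsAbelianGroup)
  open import Data.Bool.Base using (true; false)
  open import Data.Empty using (⊥-elim)
  open import Data.Fin.Base using (Fin; toℕ; zero; suc)
  open import Data.Fin.Properties
    using (_≟_; toℕ-fromℕ<; toℕ-injective; toℕ<n) renaming (suc-injective to Fin-suc-injective)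
  open import Data.Fin.Subset using (Subset; ∣_∣) renaming (_∈_ to _∈ₛ_)
  open import Data.List.Base using (List; []; _∷_; _++_; allFin; length; map)
  open import Data.List.Membership.Propositional using (_∈_)
  open import Data.List.Membership.Propositional.Properties using (∈-++⁻; ∈-allFin; ∈-map⁺; ∈-map⁻)
  open import Data.List.Properties using (length-++; length-map; length-tabulate)
  import Data.List.Relation.Unary.All as All
  import Data.List.Relation.Unary.All.Properties as All
  open import Data.List.Relation.Unary.AllPairs using ([]; _∷_)
  open import Data.List.Relation.Unary.Any using (here; there)
  open import Data.List.Relation.Unary.Unique.Propositional using (Unique)
  open import Data.List.Relation.Unary.Unique.Propositional.Properties using (allFin⁺) renaming (map⁺ to unique-map⁺)
  import Data.Nat as ℕ
  open import Data.List.Membership.DecPropositional ℕ._≟_ using (_∈?_)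
  open import Data.Nat.Base using (ℕ; zero; suc; _+_; _*_; _∸_; _%_; _/_; _≤_; _<_; NonZero)
  open import Data.Nat.DivMod
    using ( _mod_; %-distribˡ-+; %-remove-+ʳ; [m+kn]%n≡m%n; m%n%n≡m%n; m%n<n; m<n*o⇒m/o<n; m<n⇒m%n≡m
          ; m∣n⇒o%n%m≡o%m; m≡m%n+[m/n]*n; n%n≡0)
  open import Data.Nat.Divisibility
    using (_∣_; _∣?_; divides; ∣-trans; ∣m+n∣m⇒∣n; m∣m*n; n∣m*n; *-monoʳ-∣; %-presˡ-∣)
  open import Data.Nat.Primality using (Prime)
  open import Data.Nat.Properties
    using ( *-cancelʳ-≡; *-comm; *-zeroʳ; +-assoc; +-cancelʳ-≤; +-cancelˡ-≡; +-comm; 0≢1+n; <-irrefl; <⇒≤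
          ; m+[n∸m]≡n; n≤0⇒n≡0; ≤-refl; module ≤-Reasoning)
  open import Data.Product.Base using (∃-syntax; _×_; _,_)
  open import Data.Sum.Base using (inj₁; inj₂)
  open import Data.Vec.Base using ([]; _∷_; here; there; tabulate)
  open import Data.Vec.Properties using ([]=⇒lookup; lookup∘tabulate; lookup⇒[]=)
  open import Function.Base using (_∘_; id)
  open import Function.Bundles using (Equivalence)
  open import Relation.Binary.PropositionalEquality
    using (_≡_; _≢_; refl; sym; trans; cong; cong₂; subst; isEquivalence; module ≡-Reasoning)
  open import Relation.Nullary using (¬_; does; no; yes)
  open import Relation.Nullary.Decidable using (dec-true)
  open Counting

  toList : ∀ {n} → Subset n → List (Fin n)
  toList []          = []
  toList (true  ∷ p) = zero ∷ map suc (toList p)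
  toList (false ∷ p) = map suc (toList p)

  length-toList : ∀ {n} (p : Subset n) → length (toList p) ≡ ∣ p ∣
  length-toList []          = refl
  length-toList (true  ∷ p) = cong suc (trans (length-map suc (toList p)) (length-toList p))
  length-toList (false ∷ p) = trans (length-map suc (toList p)) (length-toList p)

  ∈-toList⁺ : ∀ {n} {p : Subset n} {x} → x ∈ₛ p → x ∈ toList p
  ∈-toList⁺ {p = true  ∷ p} here        = here refl
  ∈-toList⁺ {p = true  ∷ p} (there x∈p) = there (∈-map⁺ suc (∈-toList⁺ x∈p))
  ∈-toList⁺ {p = false ∷ p} (there x∈p) = ∈-map⁺ suc (∈-toList⁺ x∈p)

  ∈-toList⁻ : ∀ {n} {p : Subset n} {x} → x ∈ toList p → x ∈ₛ p
  ∈-toList⁻ {p = true  ∷ p} (here refl) = here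
  ∈-toList⁻ {p = true  ∷ p} (there x∈)
    with y , y∈p , refl ← ∈-map⁻ suc x∈ = there (∈-toList⁻ y∈p)
  ∈-toList⁻ {p = false ∷ p} x∈
    with y , y∈p , refl ← ∈-map⁻ suc x∈ = there (∈-toList⁻ y∈p)

  toList-unique : ∀ {n} (p : Subset n) → Unique (toList p)
  toList-unique []          = []
  toList-unique (true  ∷ p) = All.map⁺ (All.tabulate λ _ ()) ∷ unique-map⁺ Fin-suc-injective (toList-unique p)
  toList-unique (false ∷ p) = unique-map⁺ Fin-suc-injective (toList-unique p)

  multiples : ∀ {n} → ℕ → Subset n
  multiples d = tabulate (λ c → does (d ∣? toℕ c))

  ∈-multiples⁺ : ∀ {n d} {c : Fin n} → d ∣ toℕ c → c ∈ₛ multiples d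
  ∈-multiples⁺ {d = d} {c} d∣c =
    lookup⇒[]= c (multiples d) (trans (lookup∘tabulate (λ c → does (d ∣? toℕ c)) c) (dec-true (d ∣? toℕ c) d∣c))

  ∈-multiples⁻ : ∀ {n d} {c : Fin n} → c ∈ₛ multiples d → d ∣ toℕ c
  ∈-multiples⁻ {d = d} {c} c∈
    with d ∣? toℕ c | trans (sym (lookup∘tabulate (λ c → does (d ∣? toℕ c)) c)) ([]=⇒lookup c∈)
  ... | yes d∣c | _ = d∣c
  ... | no  _   | ()

  module _ {d : ℕ} .{{_ : NonZero d}} where

    [mod]⇒%≡% : ∀ {a b} → a ≡ b [mod d ] → a % d ≡ b % d
    [mod]⇒%≡% {a} {b} (k , l , a+kd≡b+ld) =
      trans (sym ([m+kn]%n≡m%n a k d)) (trans (cong (_% d) a+kd≡b+ld) ([m+kn]%n≡m%n b l d))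

    %≡%⇒[mod] : ∀ {a b} → a % d ≡ b % d → a ≡ b [mod d ]
    %≡%⇒[mod] {a} {b} a%d≡b%d = b / d , a / d , (begin
      a + b / d * d                  ≡⟨ cong (_+ b / d * d) (m≡m%n+[m/n]*n a d) ⟩
      a % d + a / d * d + b / d * d  ≡⟨ cong (λ r → r + a / d * d + b / d * d) a%d≡b%d ⟩
      b % d + a / d * d + b / d * d  ≡⟨ +-assoc (b % d) _ _ ⟩
      b % d + (a / d * d + b / d * d) ≡⟨ cong (b % d +_) (+-comm (a / d * d) _) ⟩
      b % d + (b / d * d + a / d * d) ≡⟨ +-assoc (b % d) _ _ ⟨
      b % d + b / d * d + a / d * d  ≡⟨ cong (_+ a / d * d) (m≡m%n+[m/n]*n b d) ⟨
      b + a / d * d                  ∎)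
      where open ≡-Reasoning

    [m+n]%d≡m%d⇒d∣n : ∀ m n → (m + n) % d ≡ m % d → d ∣ n
    [m+n]%d≡m%d⇒d∣n m n [m+n]%d≡m%d = ∣m+n∣m⇒∣n (divides ((m + n) / d) m/d*d+n≡) (n∣m*n (m / d))
      where
      open ≡-Reasoning
      m/d*d+n≡ : m / d * d + n ≡ (m + n) / d * d
      m/d*d+n≡ = +-cancelˡ-≡ (m % d) _ _ (begin
        m % d + (m / d * d + n)        ≡⟨ +-assoc (m % d) _ n ⟨
        m % d + m / d * d + n          ≡⟨ cong (_+ n) (m≡m%n+[m/n]*n m d) ⟨
        m + n                          ≡⟨ m≡m%n+[m/n]*n (m + n) d ⟩
        (m + n) % d + (m + n) / d * d  ≡⟨ cong (_+ (m + n) / d * d) [m+n]%d≡m%d ⟩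
        m % d + (m + n) / d * d        ∎)

  module Cyclic (N : ℕ) where

    ℤₙ : Set
    ℤₙ = Fin (suc N)

    toℕ-⊕ : ∀ (a b : ℤₙ) → toℕ (a ⊕ b) ≡ (toℕ a + toℕ b) % suc N
    toℕ-⊕ a b = toℕ-fromℕ< _

    private
      %-absorbˡ : ∀ a b → (a % suc N + b) % suc N ≡ (a + b) % suc N
      %-absorbˡ a b = begin
        (a % suc N + b) % suc N                  ≡⟨ %-distribˡ-+ (a % suc N) b (suc N) ⟩
        (a % suc N % suc N + b % suc N) % suc N  ≡⟨ cong (λ r → (r + b % suc N) % suc N) (m%n%n≡m%n a (suc N)) ⟩
        (a % suc N + b % suc N) % suc N          ≡⟨ %-distribˡ-+ a b (suc N) ⟨
        (a + b) % suc N                          ∎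
        where open ≡-Reasoning

      %-absorbʳ : ∀ a b → (a + b % suc N) % suc N ≡ (a + b) % suc N
      %-absorbʳ a b = trans (cong (_% suc N) (+-comm a _)) (trans (%-absorbˡ b a) (cong (_% suc N) (+-comm b a)))

    ⊖_ : ℤₙ → ℤₙ
    ⊖ a = (suc N ∸ toℕ a) mod suc N

    ⊕-comm : ∀ (a b : ℤₙ) → a ⊕ b ≡ b ⊕ a
    ⊕-comm a b = toℕ-injective (trans (toℕ-⊕ a b) (trans (cong (_% suc N) (+-comm (toℕ a) (toℕ b))) (sym (toℕ-⊕ b a))))

    ⊕-assoc : ∀ (a b c : ℤₙ) → (a ⊕ b) ⊕ c ≡ a ⊕ (b ⊕ c)
    ⊕-assoc a b c = toℕ-injective (begin
      toℕ ((a ⊕ b) ⊕ c)                          ≡⟨ toℕ-⊕ (a ⊕ b) c ⟩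
      (toℕ (a ⊕ b) + toℕ c) % suc N              ≡⟨ cong (λ x → (x + toℕ c) % suc N) (toℕ-⊕ a b) ⟩
      ((toℕ a + toℕ b) % suc N + toℕ c) % suc N  ≡⟨ %-absorbˡ (toℕ a + toℕ b) (toℕ c) ⟩
      (toℕ a + toℕ b + toℕ c) % suc N            ≡⟨ cong (_% suc N) (+-assoc (toℕ a) (toℕ b) (toℕ c)) ⟩
      (toℕ a + (toℕ b + toℕ c)) % suc N          ≡⟨ %-absorbʳ (toℕ a) (toℕ b + toℕ c) ⟨
      (toℕ a + (toℕ b + toℕ c) % suc N) % suc N  ≡⟨ cong (λ x → (toℕ a + x) % suc N) (toℕ-⊕ b c) ⟨
      (toℕ a + toℕ (b ⊕ c)) % suc N              ≡⟨ toℕ-⊕ a (b ⊕ c) ⟨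
      toℕ (a ⊕ (b ⊕ c))                          ∎)
      where open ≡-Reasoning

    ⊕-identityˡ : ∀ (a : ℤₙ) → zero ⊕ a ≡ a
    ⊕-identityˡ a = toℕ-injective (trans (toℕ-⊕ zero a) (m<n⇒m%n≡m (toℕ<n a)))

    ⊖-inverseʳ : ∀ (a : ℤₙ) → a ⊕ ⊖ a ≡ zero
    ⊖-inverseʳ a = toℕ-injective (begin
      toℕ (a ⊕ ⊖ a)                              ≡⟨ toℕ-⊕ a (⊖ a) ⟩
      (toℕ a + toℕ (⊖ a)) % suc N                ≡⟨ cong (λ x → (toℕ a + x) % suc N) (toℕ-fromℕ< _) ⟩
      (toℕ a + (suc N ∸ toℕ a) % suc N) % suc N  ≡⟨ %-absorbʳ (toℕ a) (suc N ∸ toℕ a) ⟩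
      (toℕ a + (suc N ∸ toℕ a)) % suc N          ≡⟨ cong (_% suc N) (m+[n∸m]≡n (<⇒≤ (toℕ<n a))) ⟩
      suc N % suc N                              ≡⟨ n%n≡0 (suc N) ⟩
      0                                          ∎)
      where open ≡-Reasoning

    ⊕-isAbelianGroup : IsAbelianGroup _≡_ _⊕_ zero ⊖_
    ⊕-isAbelianGroup = record
      { isGroup = record
        { isMonoid = record
          { isSemigroup = record
            { isMagma = record { isEquivalence = isEquivalence ; ∙-cong = cong₂ _⊕_ }
            ; assoc   = ⊕-assoc
            }
          ; identity = ⊕-identityˡ , (λ a → trans (⊕-comm a zero) (⊕-identityˡ a))
          }
        ; inverse = (λ a → trans (⊕-comm (⊖ a) a) (⊖-inverseʳ a)) , ⊖-inverseʳ
        ; ⁻¹-cong = cong ⊖_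
        }
      ; comm = ⊕-comm
      }

    open Tiling ⊕-isAbelianGroup _≟_ (allFin⁺ (suc N)) ∈-allFin public

    toℕ-· : ∀ k (a : ℤₙ) → toℕ (k · a) ≡ (k * toℕ a) % suc N
    toℕ-· zero    a = refl
    toℕ-· (suc k) a = trans (toℕ-⊕ a (k · a))
                            (trans (cong (λ x → (toℕ a + x) % suc N) (toℕ-· k a)) (%-absorbʳ (toℕ a) (k * toℕ a)))

    total-perfect-code⇒tiling : ∀ {S C : Subset (suc N)} → SquareFree S → TotalPerfectCode S C →
                                IsTiling (map ⊖_ (toList C)) (toList S)
    total-perfect-code⇒tiling {S} {C} square-free code =
      unique-completion⇒tiling (toList-unique S) (toList-unique C) completion
      where
      completion : ∀ g → ∃[ c ] c ∈ toList C × g ⊕ c ∈ toList S ×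
                               (∀ {c′} → c′ ∈ toList C → g ⊕ c′ ∈ toList S → c′ ≡ c)
      completion g with c , c∈C , (g⊕c∈S , _) , unique ← code g =
        c , ∈-toList⁺ c∈C , ∈-toList⁺ g⊕c∈S , λ c′∈C g⊕c′∈S →
          unique _ (∈-toList⁻ c′∈C) (∈-toList⁻ g⊕c′∈S , λ { refl → square-free g (∈-toList⁻ g⊕c′∈S) })

    DistinctResidues : ℕ → Subset (suc N) → Set
    DistinctResidues d S = ∀ s s′ → s ∈ₛ S → s′ ∈ₛ S → s ≢ s′ → ¬ (toℕ s ≡ toℕ s′ [mod d ])

    module _ {d m : ℕ} .{{_ : NonZero d}} (n≡dm : suc N ≡ d * m) where

      private
        d∣n : d ∣ suc N
        d∣n = divides m (trans n≡dm (*-comm d m))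

      residue : ℤₙ → ℕ
      residue x = toℕ x % d

      %-⊕ : ∀ (a b : ℤₙ) → toℕ (a ⊕ b) % d ≡ (toℕ a + toℕ b) % d
      %-⊕ a b = trans (cong (_% d) (toℕ-⊕ a b)) (m∣n⇒o%n%m≡o%m d (suc N) _ d∣n)

      residue-class-length : ∀ {X : List ℤₙ} {r} → Unique X → (∀ {x} → x ∈ X → toℕ x % d ≡ r) → length X ≤ m
      residue-class-length {X} X! X≡r = begin
        length X                ≡⟨ length-map quotient X ⟨
        length (map quotient X) ≤⟨ unique-<⇒length-≤ (map⁺-injectiveOn quotient X! quotient-injective) quotient<m ⟩
        m                       ∎
        where
        open ≤-Reasoning
        quotient : ℤₙ → ℕ
        quotient x = toℕ x / d
        quotient-injective : ∀ {x y} → x ∈ X → y ∈ X → quotient x ≡ quotient y → x ≡ y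
        quotient-injective {x} {y} x∈X y∈X qx≡qy = toℕ-injective (begin-equality
          toℕ x                       ≡⟨ m≡m%n+[m/n]*n (toℕ x) d ⟩
          toℕ x % d + quotient x * d  ≡⟨ cong₂ (λ r q → r + q * d) (trans (X≡r x∈X) (sym (X≡r y∈X))) qx≡qy ⟩
          toℕ y % d + quotient y * d  ≡⟨ m≡m%n+[m/n]*n (toℕ y) d ⟨
          toℕ y                       ∎)
        quotient<m : ∀ {k} → k ∈ map quotient X → k < m
        quotient<m k∈ with x , _ , refl ← ∈-map⁻ quotient k∈ =
          m<n*o⇒m/o<n (subst (toℕ x <_) (trans n≡dm (*-comm d m)) (toℕ<n x))

      residue-representative : ∀ {S} → ∣ S ∣ ≡ d → DistinctResidues d S →
                               ∀ r → r < d → ∃[ s ] s ∈ₛ S × residue s ≡ r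
      residue-representative {S} ∣S∣≡d distinct r r<d with r ∈? map residue (toList S)
      ... | yes r∈ with s , s∈S , refl ← ∈-map⁻ residue r∈ = s , ∈-toList⁻ s∈S , refl
      ... | no  r∉ = ⊥-elim (<-irrefl refl (begin-strict
        d                                  ≡⟨ trans (length-toList S) ∣S∣≡d ⟨
        length (toList S)                  ≡⟨ length-map residue (toList S) ⟨
        length (map residue (toList S))    <⟨ ≤-refl ⟩
        length (r ∷ map residue (toList S)) ≤⟨ unique-<⇒length-≤ (All.¬Any⇒All¬ _ r∉ ∷ residues!) bounded ⟩
        d                                  ∎))
        where
        open ≤-Reasoning
        residue-injective : ∀ {s s′} → s ∈ toList S → s′ ∈ toList S → residue s ≡ residue s′ → s ≡ s′
        residue-injective {s} {s′} s∈S s′∈S s%d≡s′%d with s ≟ s′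
        ... | yes s≡s′ = s≡s′
        ... | no  s≢s′ =
          ⊥-elim (distinct s s′ (∈-toList⁻ s∈S) (∈-toList⁻ s′∈S) s≢s′ (%≡%⇒[mod] s%d≡s′%d))
        residues! : Unique (map residue (toList S))
        residues! = map⁺-injectiveOn residue (toList-unique S) residue-injective
        bounded : ∀ {k} → k ∈ r ∷ map residue (toList S) → k < d
        bounded (here refl) = r<d
        bounded (there k∈) with s , _ , refl ← ∈-map⁻ residue k∈ = m%n<n (toℕ s) d

      distinct-residues⇒total-perfect-code : ∀ {S} → SquareFree S → ∣ S ∣ ≡ d → DistinctResidues d S →
                                             TotalPerfectCode S (multiples d)
      distinct-residues⇒total-perfect-code {S} square-free ∣S∣≡d distinct g
        with s , s∈S , s≡g ← residue-representative ∣S∣≡d distinct (residue g) (m%n<n (toℕ g) d) =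
        c , ∈-multiples⁺ d∣c , (g⊕c∈S , g≢c) , unique
        where
        c : ℤₙ
        c = ⊖ g ⊕ s
        g⊕c≡s : g ⊕ c ≡ s
        g⊕c≡s = Equivalence.from (∙-solve g c s) refl
        g⊕c∈S : g ⊕ c ∈ₛ S
        g⊕c∈S = subst (_∈ₛ S) (sym g⊕c≡s) s∈S
        g≢c : g ≢ c
        g≢c g≡c = square-free g (subst (λ x → g ⊕ x ∈ₛ S) (sym g≡c) g⊕c∈S)
        d∣c : d ∣ toℕ c
        d∣c = [m+n]%d≡m%d⇒d∣n (toℕ g) (toℕ c) (trans (sym (%-⊕ g c)) (trans (cong residue g⊕c≡s) s≡g))
        unique : ∀ c′ → c′ ∈ₛ multiples d → Adj S g c′ → c′ ≡ c
        unique c′ c′∈ (g⊕c′∈S , _) with g ⊕ c′ ≟ s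
        ... | yes g⊕c′≡s = Equivalence.to (∙-solve g c′ s) g⊕c′≡s
        ... | no  g⊕c′≢s = ⊥-elim (distinct _ _ g⊕c′∈S s∈S g⊕c′≢s (%≡%⇒[mod]
                (trans (%-⊕ g c′) (trans (%-remove-+ʳ (toℕ g) (∈-multiples⁻ c′∈)) (sym s≡g)))))

      -- s ⊕ A and s′ ⊕ A are disjoint since A tiles with S, have m elements each, and lie in the
      -- residue class of s, which has only m elements.
      tiling-by-multiples⇒distinct-residues : ∀ {A S} → IsTiling A (toList S) → Unique A → length A ≡ m →
                                              (∀ {a} → a ∈ A → d ∣ toℕ a) → DistinctResidues d S
      tiling-by-multiples⇒distinct-residues {A} {S} A⊕S A! |A|≡m d∣A s s′ s∈S s′∈S s≢s′ s≡s′ =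
        0≢1+n (sym (trans n≡dm (trans (cong (d *_) m≡0) (*-zeroʳ d))))
        where
        translates : List ℤₙ
        translates = map (s ⊕_) A ++ map (s′ ⊕_) A
        residue≡ : ∀ {x} → x ∈ translates → residue x ≡ residue s
        residue≡ x∈ with ∈-++⁻ (map (s ⊕_) A) x∈
        ... | inj₁ x∈sA with a , a∈A , refl ← ∈-map⁻ (s ⊕_) x∈sA =
          trans (%-⊕ s a) (%-remove-+ʳ (toℕ s) (d∣A a∈A))
        ... | inj₂ x∈s′A with a , a∈A , refl ← ∈-map⁻ (s′ ⊕_) x∈s′A =
          trans (%-⊕ s′ a) (trans (%-remove-+ʳ (toℕ s′) (d∣A a∈A)) (sym ([mod]⇒%≡% s≡s′)))
        length-translates : length translates ≡ m + m
        length-translates = trans (length-++ (map (s ⊕_) A))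
                                  (cong₂ _+_ (trans (length-map _ A) |A|≡m) (trans (length-map _ A) |A|≡m))
        translates! : Unique translates
        translates! = tiling⇒translates-unique {A} {toList S} A⊕S A! (∈-toList⁺ s∈S) (∈-toList⁺ s′∈S) s≢s′
        m≡0 : m ≡ 0
        m≡0 = n≤0⇒n≡0 (+-cancelʳ-≤ m m 0 (subst (_≤ m) length-translates (residue-class-length translates! residue≡)))

    ∣-toℕ-· : ∀ {e} k (a : ℤₙ) → e ∣ suc N → e ∣ k * toℕ a → e ∣ toℕ (k · a)
    ∣-toℕ-· k a e∣n e∣ka = subst (_ ∣_) (sym (toℕ-· k a)) (%-presˡ-∣ e∣ka e∣n)

    pq∣toℕ-q·p· : ∀ {p q} → p * q ∣ suc N → ∀ (a : ℤₙ) → p * q ∣ toℕ (q · p · a)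
    pq∣toℕ-q·p· {p} {q} pq∣n a =
      ∣-toℕ-· q (p · a) pq∣n (subst (_∣ q * toℕ (p · a)) (*-comm q p) (*-monoʳ-∣ q p∣p·a))
      where
      p∣p·a : p ∣ toℕ (p · a)
      p∣p·a = ∣-toℕ-· p a (∣-trans (m∣m*n q) pq∣n) (m∣m*n (toℕ a))

    module _ {p q m : ℕ} .{{_ : NonZero (p * q)}} (n≡pqm : suc N ≡ p * q * m) where

      total-perfect-code⇒distinct-residues : ∀ {S C : Subset (suc N)} → Prime p → Prime q → ¬ p ∣ m → ¬ q ∣ m →
        SquareFree S → ∣ S ∣ ≡ p * q → TotalPerfectCode S C → DistinctResidues (p * q) S
      total-perfect-code⇒distinct-residues {S} {C} p-prime q-prime p∤m q∤m square-free ∣S∣≡pq code s s′ s∈S =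
        tiling-by-multiples⇒distinct-residues n≡pqm {A₂} {S} A₂⊕S (tiling⇒unique {A₂} {toList S} A₂⊕S s∈toList)
          (trans (length-map _ A₁) |A₁|≡m) pq∣A₂ s s′ s∈S
        where
        s∈toList : s ∈ toList S
        s∈toList = ∈-toList⁺ s∈S
        A₀ A₁ A₂ : List ℤₙ
        A₀ = map ⊖_ (toList C)
        A₁ = map (p ·_) A₀
        A₂ = map (q ·_) A₁
        A₀⊕S : IsTiling A₀ (toList S)
        A₀⊕S = total-perfect-code⇒tiling square-free code
        |A₀|≡m : length A₀ ≡ m
        |A₀|≡m = *-cancelʳ-≡ (length A₀) m (p * q) (begin
          length A₀ * (p * q)            ≡⟨ cong (length A₀ *_) (trans (length-toList S) ∣S∣≡pq) ⟨
          length A₀ * length (toList S)  ≡⟨ tiling-size {A₀} {toList S} A₀⊕S ⟩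
          length (allFin (suc N))        ≡⟨ length-tabulate id ⟩
          suc N                          ≡⟨ trans n≡pqm (*-comm (p * q) m) ⟩
          m * (p * q)                    ∎)
          where open ≡-Reasoning
        |A₁|≡m : length A₁ ≡ m
        |A₁|≡m = trans (length-map _ A₀) |A₀|≡m
        A₁⊕S : IsTiling A₁ (toList S)
        A₁⊕S = tijdeman {A₀} {toList S} A₀⊕S (map-⁻¹-unique (toList-unique C)) p-prime
                        (subst (¬_ ∘ (p ∣_)) (sym |A₀|≡m) p∤m)
        A₂⊕S : IsTiling A₂ (toList S)
        A₂⊕S = tijdeman {A₁} {toList S} A₁⊕S (tiling⇒unique {A₁} {toList S} A₁⊕S s∈toList) q-prime
                        (subst (¬_ ∘ (q ∣_)) (sym |A₁|≡m) q∤m)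
        pq∣A₂ : ∀ {a} → a ∈ A₂ → p * q ∣ toℕ a
        pq∣A₂ a∈A₂
          with a₁ , a₁∈A₁ , refl ← ∈-map⁻ (q ·_) a∈A₂
          with a₀ , _ , refl ← ∈-map⁻ (p ·_) a₁∈A₁ =
          pq∣toℕ-q·p· {p} {q} (divides m (trans n≡pqm (*-comm (p * q) m))) a₀

open import Defs
open import Data.Nat using (ℕ; _*_)
open import Data.Nat.Primality using (Prime)
open import Data.Nat.Coprimality using (Coprime)
open import Data.Fin using (Fin; toℕ)
open import Data.Fin.Subset using (Subset; _∈_; ∣_∣)
open import Data.Product using (Σ; ∃; _×_)
open import Data.Sum using (_⊎_)
open import Relation.Binary.PropositionalEquality using (_≡_; _≢_)
open import Relation.Nullary using (¬_)
open import Function.Bundles using (_⇔_)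

open import Data.Empty using (⊥-elim)
open import Data.Nat.Base using (zero; suc; NonZero; ≢-nonZero⁻¹)
open import Data.Nat.Divisibility using (_∣_; m∣m*n; n∣m*n)
open import Data.Nat.Primality using (prime⇒nonZero; ¬prime[1])
open import Data.Nat.Properties using (m*n≢0)
open import Data.Product using (_,_)
open import Data.Vec.Base using ([])
open import Function.Bundles using (mk⇔)
open import Relation.Binary.PropositionalEquality using (sym; trans; cong; subst)
open CyclicGroups

prime*prime-nonZero : ∀ {p q} → Prime p → Prime q → NonZero (p * q)
prime*prime-nonZero p-prime q-prime = m*n≢0 _ _ {{prime⇒nonZero p-prime}} {{prime⇒nonZero q-prime}}

prime∣coprime⇒∤ : ∀ {p d m} → Prime p → p ∣ d → Coprime d m → ¬ p ∣ m
prime∣coprime⇒∤ p-prime p∣d d⊥m p∣m = ¬prime[1] (subst Prime (d⊥m (p∣d , p∣m)) p-prime)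

lemma3p12 : (n p q r : ℕ) → Prime p → Prime q → Prime r → p ≢ q → p ≢ r → q ≢ r →
    (n ≡ p * q * r ⊎ Σ ℕ (λ s → Prime s × p ≢ s × q ≢ s × r ≢ s × n ≡ p * q * r * s)) →
    (S : Subset n) → SquareFree S → Aperiodic S → ∣ S ∣ ≡ p * q →
    Σ ℕ (λ m → n ≡ ∣ S ∣ * m × Coprime ∣ S ∣ m) →
    Connected S →
    (∃ (λ C → TotalPerfectCode S C)
      ⇔ (∀ s s' → s ∈ S → s' ∈ S → s ≢ s' → ¬ (toℕ s ≡ toℕ s' [mod p * q ])))
lemma3p12 zero p q _ p-prime q-prime _ _ _ _ _ [] _ _ 0≡pq _ _ =
  ⊥-elim (≢-nonZero⁻¹ (p * q) {{prime*prime-nonZero p-prime q-prime}} (sym 0≡pq))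
lemma3p12 (suc N) p q _ p-prime q-prime _ _ _ _ _ S square-free _ ∣S∣≡pq (m , n≡∣S∣m , ∣S∣⊥m) _ =
  mk⇔ (λ (C , code) → total-perfect-code⇒distinct-residues n≡pqm p-prime q-prime p∤m q∤m square-free ∣S∣≡pq code)
      (λ distinct → multiples (p * q) , distinct-residues⇒total-perfect-code n≡pqm square-free ∣S∣≡pq distinct)
  where
  open Cyclic N
  instance
    pq≢0 : NonZero (p * q)
    pq≢0 = prime*prime-nonZero p-prime q-prime
  n≡pqm : suc N ≡ p * q * m
  n≡pqm = trans n≡∣S∣m (cong (_* m) ∣S∣≡pq)
  p∤m : ¬ p ∣ m
  p∤m = prime∣coprime⇒∤ p-prime (subst (p ∣_) (sym ∣S∣≡pq) (m∣m*n q)) ∣S∣⊥m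
  q∤m : ¬ q ∣ m
  q∤m = prime∣coprime⇒∤ q-prime (subst (q ∣_) (sym ∣S∣≡pq) (n∣m*n p)) ∣S∣⊥m
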